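{- Let $\mathcal B$ be the set of plane binary trees with at least one internal node (a plane binary tree is either a leaf or an internal node with an ordered pair of subtrees, left and right; its size is its number of internal nodes). Define $\varphi:\mathcal B\to\mathcal T$ recursively as follows, for a tree whose root has left subtree $\ell$ and right subtree $r$: (1) if $\ell$ and $r$ are leaves, $\varphi=\underline{0}$; (2) if $\ell$ is a leaf and $r$ is not, $\varphi=\lambda\,\varphi(r)$; (3) if neither $\ell$ nor $r$ is a leaf, $\varphi=\varphi(\ell)\,\varphi(r)$; (4) if $\ell$ is not a leaf and $r$ is a leaf, let $\ell_1,\ell_2$ be the left and right subtrees of the root of $\ell$: (4a) if $\ell_1$ is a leaf and $\ell_2$ is not, $\varphi=\varphi(\ell_2)[\uparrow]$; (4b) if neither $\ell_1$ nor $\ell_2$ is a leaf, $\varphi=\varphi(\ell_1)[\varphi(\ell_2)/]$; (4c) if $\ell_2$ is a leaf, then $\varphi(\ell)$ is either a de Bruijn index $\underline{n}$, in which case $\varphi=\mathtt{S}\,\underline{n}$ (i.e. $\underline{n+1}$), or a closure $a[\Uparrow^{k}(s)]$ with $k\ge0$ and $s$ not of the form $\Uparrow(\cdot)$, in which case $\varphi=a[\Uparrow^{k+1}(s)]$. Then $\varphi$ is a bijection from $\mathcal B$ onto the set $\mathcal T$ of all $\lambda\upsilon$-terms, and it preserves size: a tree with $n$ internal nodes is mapped to a $\lambda\upsilon$-term of size $n$.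
   Context: $\lambda\upsilon$-terms ($\mathcal T$) and substitutions ($\mathcal S$) are generated by the grammar $\mathcal T ::= \mathcal N \mid \lambda\mathcal T \mid \mathcal T\,\mathcal T \mid \mathcal T[\mathcal S]$, $\mathcal S ::= \mathcal T/ \mid \Uparrow(\mathcal S) \mid \uparrow$, $\mathcal N ::= \underline{0} \mid \mathtt{S}\,\mathcal N$, where $\underline{n}$ is the $n$-fold application of the successor constructor $\mathtt{S}$ to $\underline{0}$, and $\Uparrow^k(s)$ denotes $k$ applications of $\Uparrow$ to $s$ ($\Uparrow^0(s)=s$). Size counts constructors: $|\underline{n}|=n+1$, $|\lambda a|=1+|a|$, $|a\,b|=1+|a|+|b|$, $|a[s]|=1+|a|+|s|$, $|a/|=1+|a|$, $|\Uparrow(s)|=1+|s|$, $|\uparrow|=1$. -}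

module Defs where

open import Data.Nat using (ℕ; zero; suc; _+_)
open import Data.Product using (Σ; _,_)
open import Relation.Binary.PropositionalEquality using (_≡_)

data Nat' : Set where
  Z : Nat'
  S : Nat' → Nat'

mutual
  data Term : Set where
    idx  : Nat' → Term
    lam  : Term → Term
    app  : Term → Term → Term
    clos : Term → Subst → Term

  data Subst : Set where
    slash : Term → Subst
    lift  : Subst → Subst
    shift : Subst

sizeN : Nat' → ℕ
sizeN Z = 1
sizeN (S n) = suc (sizeN n)

mutual
  sizeT : Term → ℕ
  sizeT (idx n) = sizeN n
  sizeT (lam a) = suc (sizeT a)
  sizeT (app a b) = suc (sizeT a + sizeT b)
  sizeT (clos a s) = suc (sizeT a + sizeS s)

  sizeS : Subst → ℕ
  sizeS (slash a) = suc (sizeT a)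
  sizeS (lift s) = suc (sizeS s)
  sizeS shift = 1

data Tree : Set where
  leaf : Tree
  node : Tree → Tree → Tree

size : Tree → ℕ
size leaf = 0
size (node l r) = suc (size l + size r)

data IsNode : Tree → Set where
  isNode : (l r : Tree) → IsNode (node l r)

𝓑 : Set
𝓑 = Σ Tree IsNode

liftUnder : Subst → Subst
liftUnder (lift s) = lift (liftUnder s)
liftUnder s = lift s

-- rule (4c): n̲ ↦ S n̲ ;  a[⇑^k(s)] ↦ a[⇑^(k+1)(s)].
-- (Other shapes never arise as φ(ℓ) here; the fallback value is irrelevant.)
bump : Term → Term
bump (idx n) = idx (S n)
bump (clos a s) = clos a (liftUnder s)
bump t = t

φnode : Tree → Tree → Term
φnode leaf leaf = idx Z
φnode leaf (node a b) = lam (φnode a b)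
φnode (node a b) (node c d) = app (φnode a b) (φnode c d)
φnode (node leaf (node c d)) leaf = clos (φnode c d) shift
φnode (node (node a b) (node c d)) leaf = clos (φnode a b) (slash (φnode c d))
φnode (node l₁ leaf) leaf = bump (φnode l₁ leaf)

φ : 𝓑 → Term
φ (_ , isNode l r) = φnode l r

-- φ has an explicit inverse, `encode`, which reads the four rules backwards: an index n̲ becomes a
-- left comb of n+1 nodes and a closure a[⇑ᵏ(s)] stacks k extra nodes with a leaf as right child on
-- top of the encoding of a[s] (rule 4c). The only subtlety is that `bump` commutes with encoding
-- only on indices and closures, but these are exactly the values φ takes on trees with a leaf as
-- right child of a non-leaf. Size is preserved because every constructor of a term, including each
-- S and each ⇑, is encoded by exactly one internal node.
module Submission where

open import Defs
open import Data.Product using (_×_; proj₁; _,_)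
open import Data.Nat using (suc; _+_)
open import Data.Nat.Properties using (+-identityʳ; +-suc)
open import Relation.Binary.PropositionalEquality
  using (_≡_; refl; cong; cong₂; sym; trans; module ≡-Reasoning)
open import Function.Definitions using (Bijective)
open import Function.Consequences.Propositional
  using (inverseᵇ⇒bijective; strictlyInverseˡ⇒inverseˡ; strictlyInverseʳ⇒inverseʳ)

liftUnder≗lift : ∀ s → liftUnder s ≡ lift s
liftUnder≗lift (slash a) = refl
liftUnder≗lift (lift s) = cong lift (liftUnder≗lift s)
liftUnder≗lift shift = refl

φnode-bump : ∀ x → φnode (node x leaf) leaf ≡ bump (φnode x leaf)
φnode-bump leaf = refl
φnode-bump (node _ _) = refl

𝓑-≡ : {x y : 𝓑} → proj₁ x ≡ proj₁ y → x ≡ y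
𝓑-≡ {_ , isNode l r} {_ , isNode .l .r} refl = refl

encodeIndex : Nat' → Tree
encodeIndex Z = leaf
encodeIndex (S n) = node (encodeIndex n) leaf

-- The root is built syntactically as a node, so that φ (encode⁺ t) computes by φnode.
mutual
  encode : Term → Tree
  encode t = node (encodeˡ t) (encodeʳ t)

  encodeˡ : Term → Tree
  encodeˡ (idx n) = encodeIndex n
  encodeˡ (lam a) = leaf
  encodeˡ (app a b) = encode a
  encodeˡ (clos a s) = encodeClosure a s

  encodeʳ : Term → Tree
  encodeʳ (idx n) = leaf
  encodeʳ (lam a) = encode a
  encodeʳ (app a b) = encode b
  encodeʳ (clos a s) = leaf

  encodeClosure : Term → Subst → Tree
  encodeClosure a shift = node leaf (encode a)
  encodeClosure a (slash b) = node (encode a) (encode b)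
  encodeClosure a (lift s) = node (encodeClosure a s) leaf

encode⁺ : Term → 𝓑
encode⁺ t = encode t , isNode _ _

φnode-encodeIndex : ∀ n → φnode (encodeIndex n) leaf ≡ idx n
φnode-encodeIndex Z = refl
φnode-encodeIndex (S n) =
  trans (φnode-bump (encodeIndex n)) (cong bump (φnode-encodeIndex n))

mutual
  φ-encode⁺ : ∀ t → φ (encode⁺ t) ≡ t
  φ-encode⁺ (idx n) = φnode-encodeIndex n
  φ-encode⁺ (lam a) = cong lam (φ-encode⁺ a)
  φ-encode⁺ (app a b) = cong₂ app (φ-encode⁺ a) (φ-encode⁺ b)
  φ-encode⁺ (clos a s) = φnode-encodeClosure a s

  φnode-encodeClosure : ∀ a s → φnode (encodeClosure a s) leaf ≡ clos a s
  φnode-encodeClosure a shift = cong (λ a′ → clos a′ shift) (φ-encode⁺ a)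
  φnode-encodeClosure a (slash b) =
    cong₂ (λ a′ b′ → clos a′ (slash b′)) (φ-encode⁺ a) (φ-encode⁺ b)
  φnode-encodeClosure a (lift s) = begin
    φnode (node (encodeClosure a s) leaf) leaf ≡⟨ φnode-bump (encodeClosure a s) ⟩
    bump (φnode (encodeClosure a s) leaf)      ≡⟨ cong bump (φnode-encodeClosure a s) ⟩
    clos a (liftUnder s)                       ≡⟨ cong (clos a) (liftUnder≗lift s) ⟩
    clos a (lift s)                            ∎
    where open ≡-Reasoning

data IndexOrClosure : Term → Set where
  index   : ∀ n → IndexOrClosure (idx n)
  closure : ∀ a s → IndexOrClosure (clos a s)

bump-IndexOrClosure : ∀ {t} → IndexOrClosure t → IndexOrClosure (bump t)
bump-IndexOrClosure (index n) = index (S n)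
bump-IndexOrClosure (closure a s) = closure a (liftUnder s)

φnode-node-leaf-IndexOrClosure : ∀ x y → IndexOrClosure (φnode (node x y) leaf)
φnode-node-leaf-IndexOrClosure leaf leaf = index (S Z)
φnode-node-leaf-IndexOrClosure leaf (node _ _) = closure _ _
φnode-node-leaf-IndexOrClosure (node _ _) (node _ _) = closure _ _
φnode-node-leaf-IndexOrClosure (node x y) leaf =
  bump-IndexOrClosure (φnode-node-leaf-IndexOrClosure x y)

encode-bump : ∀ {t} → IndexOrClosure t → encode (bump t) ≡ node (encode t) leaf
encode-bump (index n) = refl
encode-bump (closure a s) =
  cong (λ s′ → node (encodeClosure a s′) leaf) (liftUnder≗lift s)

encode-φnode : ∀ l r → encode (φnode l r) ≡ node l r
encode-φnode leaf leaf = refl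
encode-φnode leaf (node a b) = cong (node leaf) (encode-φnode a b)
encode-φnode (node a b) (node c d) = cong₂ node (encode-φnode a b) (encode-φnode c d)
encode-φnode (node leaf (node c d)) leaf =
  cong (λ r → node (node leaf r) leaf) (encode-φnode c d)
encode-φnode (node (node a b) (node c d)) leaf =
  cong₂ (λ l r → node (node l r) leaf) (encode-φnode a b) (encode-φnode c d)
encode-φnode (node leaf leaf) leaf = refl
encode-φnode (node (node x y) leaf) leaf = begin
  encode (bump (φnode (node x y) leaf)) ≡⟨ encode-bump (φnode-node-leaf-IndexOrClosure x y) ⟩
  node (encode (φnode (node x y) leaf)) leaf ≡⟨ cong (λ l → node l leaf) (encode-φnode (node x y) leaf) ⟩
  node (node (node x y) leaf) leaf          ∎
  where open ≡-Reasoning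

encode⁺-φ : ∀ b → encode⁺ (φ b) ≡ b
encode⁺-φ (_ , isNode l r) = 𝓑-≡ (encode-φnode l r)

size-encodeIndex : ∀ n → suc (size (encodeIndex n)) ≡ sizeN n
size-encodeIndex Z = refl
size-encodeIndex (S n) =
  cong suc (trans (cong suc (+-identityʳ (size (encodeIndex n)))) (size-encodeIndex n))

mutual
  size-encode : ∀ t → size (encode t) ≡ sizeT t
  size-encode (idx n) = trans (cong suc (+-identityʳ _)) (size-encodeIndex n)
  size-encode (lam a) = cong suc (size-encode a)
  size-encode (app a b) = cong suc (cong₂ _+_ (size-encode a) (size-encode b))
  size-encode (clos a s) =
    cong suc (trans (+-identityʳ _) (size-encodeClosure a s))

  size-encodeClosure : ∀ a s → size (encodeClosure a s) ≡ sizeT a + sizeS s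
  size-encodeClosure a shift =
    trans (cong suc (size-encode a)) (sym (trans (+-suc (sizeT a) 0) (cong suc (+-identityʳ _))))
  size-encodeClosure a (slash b) =
    trans (cong suc (cong₂ _+_ (size-encode a) (size-encode b))) (sym (+-suc (sizeT a) (sizeT b)))
  size-encodeClosure a (lift s) =
    trans (cong suc (trans (+-identityʳ _) (size-encodeClosure a s))) (sym (+-suc (sizeT a) (sizeS s)))

mainTheorem2 : Bijective _≡_ _≡_ φ × ((b : 𝓑) → sizeT (φ b) ≡ size (proj₁ b))
mainTheorem2 = bijective , sizeT-φ
  where
  bijective : Bijective _≡_ _≡_ φ
  bijective = inverseᵇ⇒bijective
    ( strictlyInverseˡ⇒inverseˡ {f⁻¹ = encode⁺} φ φ-encode⁺
    , strictlyInverseʳ⇒inverseʳ {f⁻¹ = encode⁺} φ encode⁺-φ )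

  sizeT-φ : (b : 𝓑) → sizeT (φ b) ≡ size (proj₁ b)
  sizeT-φ b = begin
    sizeT (φ b)                ≡⟨ sym (size-encode (φ b)) ⟩
    size (encode (φ b))        ≡⟨ cong (λ b′ → size (proj₁ b′)) (encode⁺-φ b) ⟩
    size (proj₁ b)             ∎
    where open ≡-Reasoning
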